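{- Let $X$ be a finite alphabet with $|X|=N$ whose symbols are of types GEN, PROP, KILL with counts $g,t,k$, $g+k\ge1$. Let $x_1,x_2,\dots$ be i.i.d. uniform on $X$, $\sigma_0\sim\pi=(\pi_0,\pi_1)=(k/(g+k),g/(g+k))$ independent of the $x_j$, $\sigma_j=T_{x_j}(\sigma_{j-1})$, $\mu=t/N$, and $\nu=\sum_{j=1}^L\sigma_j$. Then for $L\ge1$ \[\mathrm{Var}(\nu)=\pi_1\pi_0\left[\frac{L(1+\mu)}{1-\mu}-\frac{2\mu(1-\mu^L)}{(1-\mu)^2}\right].\]
   Context: GEN symbols act on the state space $\{0,1\}$ as the constant map $1$, PROP as the identity, KILL as the constant map $0$; $T_x$ is the action of $x$. -}

module Defs where

open import Data.Nat as ℕ using (ℕ; zero; suc)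
open import Data.Fin using (Fin; zero; suc)
open import Data.Vec using (Vec; []; _∷_)
import Data.Rational
open import Data.Rational using (ℚ; 0ℚ; 1ℚ; _+_; _*_; _-_; 1/_; _≟_; ≢-nonZero)
open import Relation.Nullary using (yes; no)

data SymType : Set where
  GEN PROP KILL : SymType

State : Set
State = Fin 2

act : SymType → State → State
act GEN  σ = suc zero
act PROP σ = σ
act KILL σ = zero

-- Total inverse on ℚ (1/0 := 0); only ever applied to nonzero values below
inv : ℚ → ℚ
inv q with q ≟ 0ℚ
... | yes _ = 0ℚ
... | no q≢0 = 1/_ q {{≢-nonZero q≢0}}

fromℕ : ℕ → ℚ
fromℕ n = (Data.Integer.+ n) Data.Rational./ 1
  where import Data.Integer

_÷'_ : ℚ → ℚ → ℚ
p ÷' q = p * inv q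

_^'_ : ℚ → ℕ → ℚ
q ^' zero = 1ℚ
q ^' suc n = q * (q ^' n)

sumFin : (n : ℕ) → (Fin n → ℚ) → ℚ
sumFin zero    f = 0ℚ
sumFin (suc n) f = f zero + sumFin n (λ i → f (suc i))

count : {N : ℕ} → (Fin N → SymType) → SymType → ℕ
count {zero}  ty s = 0
count {suc N} ty s = c (ty zero) s ℕ.+ count {N} (λ i → ty (suc i)) s
  where
  c : SymType → SymType → ℕ
  c GEN GEN = 1
  c PROP PROP = 1
  c KILL KILL = 1
  c _ _ = 0

module Model {N : ℕ} (ty : Fin N → SymType) where
  g t k : ℕ
  g = count ty GEN
  t = count ty PROP
  k = count ty KILL

  π : State → ℚ
  π zero       = fromℕ k ÷' fromℕ (g ℕ.+ k)
  π (suc zero) = fromℕ g ÷' fromℕ (g ℕ.+ k)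

  μ : ℚ
  μ = fromℕ t ÷' fromℕ N

  ν : {L : ℕ} → State → Vec (Fin N) L → ℕ
  ν σ [] = 0
  ν σ (x ∷ w) = Data.Fin.toℕ (act (ty x) σ) ℕ.+ ν (act (ty x) σ) w

  -- sum over all words of length L, each with probability (1/N)^L
  sumWords : (L : ℕ) → (Vec (Fin N) L → ℚ) → ℚ
  sumWords zero    f = f []
  sumWords (suc L) f = sumFin N (λ x → inv (fromℕ N) * sumWords L (λ w → f (x ∷ w)))

  E : (L : ℕ) → (State → Vec (Fin N) L → ℚ) → ℚ
  E L f = sumFin 2 (λ σ → π σ * sumWords L (f σ))

  Varν : ℕ → ℚ
  Varν L = E L (λ σ w → fromℕ (ν σ w) * fromℕ (ν σ w))
         - E L (λ σ w → fromℕ (ν σ w)) * E L (λ σ w → fromℕ (ν σ w))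

{-# OPTIONS --safe #-}
-- A PROP symbol keeps the state and any other symbol redraws it from π (it resets to 1
-- with probability g/N = (1 - μ) π₁). Hence π is stationary and one step multiplies the
-- deviation σ - π₁ by μ in mean, so E[ν | σ₀ = σ] = L π₁ + (μ + ⋯ + μᴸ)(σ - π₁).
-- Splitting off the first symbol, ν = σ₁ + ν′ with σ₁ again π-distributed, so E ν² grows
-- by π₁ (1 + 2 E[ν | σ₀ = 1]) per symbol. Altogether Var ν = π₀ π₁ Σ_{i,j ≤ L} μ^|i-j|,
-- a geometric double sum.
module Submission where

open import Defs
open import Data.Nat using (ℕ; _≤_; _+_)
open import Data.Fin using (Fin; zero; suc)
open import Data.Rational using (ℚ; 1ℚ; _*_; _-_)
import Data.Rational
open import Relation.Binary.PropositionalEquality using (_≡_)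

open import Data.Nat using (zero; suc; NonZero; >-nonZero)
open import Data.Fin using (toℕ)
open import Data.Vec using (Vec; []; _∷_)
import Data.Integer as ℤ
import Data.Integer.Properties as ℤ
open import Data.Rational using (0ℚ; mkℚ; ↥_; _≟_; ≢-nonZero) renaming (_+_ to _⊕_)
import Data.Rational.Properties as ℚ
open import Data.Nat.Coprimality using (1-coprimeTo) renaming (sym to coprime-sym)
open import Data.Empty using (⊥-elim)
open import Function using (_∘_)
open import Level using (0ℓ)
open import Relation.Nullary using (yes; no)
open import Relation.Nullary.Decidable using (dec⇒maybe)
open import Relation.Binary.PropositionalEquality
  using (_≢_; refl; sym; trans; cong; cong₂; module ≡-Reasoning)
open import Tactic.RingSolver using (solve-∀)
open import Tactic.RingSolver.Core.AlmostCommutativeRing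
  using (AlmostCommutativeRing; fromCommutativeRing)

open ≡-Reasoning

ℚ-ring : AlmostCommutativeRing 0ℓ 0ℓ
ℚ-ring = fromCommutativeRing ℚ.+-*-commutativeRing (λ q → dec⇒maybe (0ℚ ≟ q))

-- fromℕ n normalises + n / 1 by a gcd computation, which is stuck when n is a variable.
fromℕ-mkℚ : ∀ n → fromℕ n ≡ mkℚ (ℤ.+ n) 0 (coprime-sym (1-coprimeTo n))
fromℕ-mkℚ n = ℚ.normalize-coprime (coprime-sym (1-coprimeTo n))

fromℕ-suc : ∀ n → fromℕ (suc n) ≡ 1ℚ ⊕ fromℕ n
fromℕ-suc n rewrite fromℕ-mkℚ n =
  -- the right-hand side computes to (1ℤ ℤ.+ ℤ.+ n ℤ.* 1ℤ) / 1
  ℚ./-cong {p₁ = ℤ.+ suc n} (cong (λ z → ℤ.1ℤ ℤ.+ z) (sym (ℤ.*-identityʳ (ℤ.+ n)))) refl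

fromℕ-+ : ∀ m n → fromℕ (m + n) ≡ fromℕ m ⊕ fromℕ n
fromℕ-+ zero    n = sym (ℚ.+-identityˡ (fromℕ n))
fromℕ-+ (suc m) n = begin
  fromℕ (suc (m + n))      ≡⟨ fromℕ-suc (m + n) ⟩
  1ℚ ⊕ fromℕ (m + n)       ≡⟨ cong (1ℚ ⊕_) (fromℕ-+ m n) ⟩
  1ℚ ⊕ (fromℕ m ⊕ fromℕ n) ≡⟨ ℚ.+-assoc 1ℚ (fromℕ m) (fromℕ n) ⟨
  (1ℚ ⊕ fromℕ m) ⊕ fromℕ n ≡⟨ cong (_⊕ fromℕ n) (fromℕ-suc m) ⟨
  fromℕ (suc m) ⊕ fromℕ n  ∎

fromℕ≢0 : ∀ n .{{_ : NonZero n}} → fromℕ n ≢ 0ℚ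
fromℕ≢0 (suc n) eq with cong ↥_ (trans (sym (fromℕ-mkℚ (suc n))) eq)
... | ()

inv-inverseʳ : ∀ q → q ≢ 0ℚ → q * inv q ≡ 1ℚ
inv-inverseʳ q q≢0 with q ≟ 0ℚ
... | yes q≡0 = ⊥-elim (q≢0 q≡0)
... | no  q≢0 = ℚ.*-inverseʳ q {{≢-nonZero q≢0}}

*-cancelˡ : ∀ q {a b} → q ≢ 0ℚ → q * a ≡ q * b → a ≡ b
*-cancelˡ q {a} {b} q≢0 qa≡qb = begin
  a                   ≡⟨ unit a ⟨
  inv q * (q * a)     ≡⟨ cong (inv q *_) qa≡qb ⟩
  inv q * (q * b)     ≡⟨ unit b ⟩
  b                   ∎
  where
  reassoc : ∀ i q x → i * (q * x) ≡ (q * i) * x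
  reassoc = solve-∀ ℚ-ring
  unit : ∀ x → inv q * (q * x) ≡ x
  unit x = trans (reassoc (inv q) q x)
                 (trans (cong (_* x) (inv-inverseʳ q q≢0)) (ℚ.*-identityˡ x))

square≢0 : ∀ {q} → q ≢ 0ℚ → q * q ≢ 0ℚ
square≢0 {q} q≢0 qq≡0 = q≢0 (*-cancelˡ q q≢0 (trans qq≡0 (sym (ℚ.*-zeroʳ q))))

÷'-by-square : ∀ d {v} x y → d ≢ 0ℚ → d * d * v ≡ x * d - y → v ≡ x ÷' d - y ÷' (d * d)
÷'-by-square d {v} x y d≢0 eq =
  *-cancelˡ (d * d) dd≢0 (trans eq (sym (begin
    d * d * (x * inv d - y * inv (d * d))
      ≡⟨ expand x y d (inv d) (inv (d * d)) ⟩
    x * (d * inv d) * d - y * (d * d * inv (d * d))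
      ≡⟨ cong₂ (λ a b → x * a * d - y * b) (inv-inverseʳ d d≢0) (inv-inverseʳ (d * d) dd≢0) ⟩
    x * 1ℚ * d - y * 1ℚ
      ≡⟨ cong₂ (λ a b → a * d - b) (ℚ.*-identityʳ x) (ℚ.*-identityʳ y) ⟩
    x * d - y
      ∎)))
  where
  dd≢0 : d * d ≢ 0ℚ
  dd≢0 = square≢0 d≢0
  expand : ∀ x y d i j → d * d * (x * i - y * j) ≡ x * (d * i) * d - y * (d * d * j)
  expand = solve-∀ ℚ-ring

sumFin-cong : ∀ n {f h : Fin n → ℚ} → (∀ i → f i ≡ h i) → sumFin n f ≡ sumFin n h
sumFin-cong zero    eq = refl
sumFin-cong (suc n) eq = cong₂ _⊕_ (eq zero) (sumFin-cong n (eq ∘ suc))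

sumFin-+ : ∀ n (f h : Fin n → ℚ) → sumFin n (λ i → f i ⊕ h i) ≡ sumFin n f ⊕ sumFin n h
sumFin-+ zero    f h = sym (ℚ.+-identityˡ 0ℚ)
sumFin-+ (suc n) f h = trans (cong (f zero ⊕ h zero ⊕_) (sumFin-+ n (f ∘ suc) (h ∘ suc)))
                             (interchange (f zero) (h zero) _ _)
  where
  interchange : ∀ a b c d → (a ⊕ b) ⊕ (c ⊕ d) ≡ (a ⊕ c) ⊕ (b ⊕ d)
  interchange = solve-∀ ℚ-ring

sumFin-*ˡ : ∀ n c (f : Fin n → ℚ) → sumFin n (λ i → c * f i) ≡ c * sumFin n f
sumFin-*ˡ zero    c f = sym (ℚ.*-zeroʳ c)
sumFin-*ˡ (suc n) c f = trans (cong (c * f zero ⊕_) (sumFin-*ˡ n c (f ∘ suc)))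
                              (sym (ℚ.*-distribˡ-+ c (f zero) _))

sumFin-const : ∀ n c → sumFin n (λ _ → c) ≡ fromℕ n * c
sumFin-const zero    c = sym (ℚ.*-zeroˡ c)
sumFin-const (suc n) c = begin
  c ⊕ sumFin n (λ _ → c)  ≡⟨ cong (c ⊕_) (sumFin-const n c) ⟩
  c ⊕ fromℕ n * c         ≡⟨ cong (_⊕ fromℕ n * c) (ℚ.*-identityˡ c) ⟨
  1ℚ * c ⊕ fromℕ n * c    ≡⟨ ℚ.*-distribʳ-+ c 1ℚ (fromℕ n) ⟨
  (1ℚ ⊕ fromℕ n) * c      ≡⟨ cong (_* c) (fromℕ-suc n) ⟨
  fromℕ (suc n) * c       ∎

δ : SymType → SymType → ℕ
δ GEN  GEN  = 1
δ PROP PROP = 1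
δ KILL KILL = 1
δ _    _    = 0

count-suc : ∀ {N} (ty : Fin (suc N) → SymType) s → count ty s ≡ δ (ty zero) s + count (ty ∘ suc) s
count-suc ty s with ty zero | s
... | GEN  | GEN  = refl
... | GEN  | PROP = refl
... | GEN  | KILL = refl
... | PROP | GEN  = refl
... | PROP | PROP = refl
... | PROP | KILL = refl
... | KILL | GEN  = refl
... | KILL | PROP = refl
... | KILL | KILL = refl

byType : ℕ → ℕ → ℕ → (SymType → ℚ) → ℚ
byType a b c f = fromℕ a * f GEN ⊕ fromℕ b * f PROP ⊕ fromℕ c * f KILL

byType-δ : ∀ T a b c f → byType (δ T GEN + a) (δ T PROP + b) (δ T KILL + c) f ≡ f T ⊕ byType a b c f
byType-δ GEN  a b c f rewrite fromℕ-suc a = insert₁ (fromℕ a) (fromℕ b) (fromℕ c) _ _ _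
  where
  insert₁ : ∀ a b c x y z → (1ℚ ⊕ a) * x ⊕ b * y ⊕ c * z ≡ x ⊕ (a * x ⊕ b * y ⊕ c * z)
  insert₁ = solve-∀ ℚ-ring
byType-δ PROP a b c f rewrite fromℕ-suc b = insert₂ (fromℕ a) (fromℕ b) (fromℕ c) _ _ _
  where
  insert₂ : ∀ a b c x y z → a * x ⊕ (1ℚ ⊕ b) * y ⊕ c * z ≡ y ⊕ (a * x ⊕ b * y ⊕ c * z)
  insert₂ = solve-∀ ℚ-ring
byType-δ KILL a b c f rewrite fromℕ-suc c = insert₃ (fromℕ a) (fromℕ b) (fromℕ c) _ _ _
  where
  insert₃ : ∀ a b c x y z → a * x ⊕ b * y ⊕ (1ℚ ⊕ c) * z ≡ z ⊕ (a * x ⊕ b * y ⊕ c * z)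
  insert₃ = solve-∀ ℚ-ring

sumFin-byType : ∀ {N} (ty : Fin N → SymType) (f : SymType → ℚ) →
  sumFin N (f ∘ ty) ≡ byType (count ty GEN) (count ty PROP) (count ty KILL) f
sumFin-byType {zero}  ty f = empty (f GEN) (f PROP) (f KILL)
  where
  empty : ∀ x y z → 0ℚ ≡ 0ℚ * x ⊕ 0ℚ * y ⊕ 0ℚ * z
  empty = solve-∀ ℚ-ring
sumFin-byType {suc N} ty f
  rewrite count-suc ty GEN | count-suc ty PROP | count-suc ty KILL = begin
    f (ty zero) ⊕ sumFin N (f ∘ ty ∘ suc)  ≡⟨ cong (f (ty zero) ⊕_) (sumFin-byType (ty ∘ suc) f) ⟩
    f (ty zero) ⊕ byType g t k f           ≡⟨ byType-δ (ty zero) g t k f ⟨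
    byType (δ (ty zero) GEN + g) (δ (ty zero) PROP + t) (δ (ty zero) KILL + k) f  ∎
  where
  g t k : ℕ
  g = count (ty ∘ suc) GEN
  t = count (ty ∘ suc) PROP
  k = count (ty ∘ suc) KILL

count-total : ∀ {N} (ty : Fin N → SymType) →
  fromℕ (count ty GEN) ⊕ fromℕ (count ty PROP) ⊕ fromℕ (count ty KILL) ≡ fromℕ N
count-total {N} ty = begin
  fromℕ g ⊕ fromℕ t ⊕ fromℕ k  ≡⟨ cong₂ _⊕_ (cong₂ _⊕_ (ℚ.*-identityʳ (fromℕ g)) (ℚ.*-identityʳ (fromℕ t)))
                                           (ℚ.*-identityʳ (fromℕ k)) ⟨
  byType g t k (λ _ → 1ℚ)      ≡⟨ sumFin-byType ty (λ _ → 1ℚ) ⟨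
  sumFin N (λ _ → 1ℚ)          ≡⟨ sumFin-const N 1ℚ ⟩
  fromℕ N * 1ℚ                 ≡⟨ ℚ.*-identityʳ (fromℕ N) ⟩
  fromℕ N                      ∎
  where
  g t k : ℕ
  g = count ty GEN
  t = count ty PROP
  k = count ty KILL

geomSum : ℚ → ℕ → ℚ
geomSum μ zero    = 0ℚ
geomSum μ (suc L) = μ * (1ℚ ⊕ geomSum μ L)

geomSum-closed : ∀ μ L → (1ℚ - μ) * geomSum μ L ≡ μ * (1ℚ - μ ^' L)
geomSum-closed μ zero    = base μ
  where
  base : ∀ μ → (1ℚ - μ) * 0ℚ ≡ μ * (1ℚ - 1ℚ)
  base = solve-∀ ℚ-ring
geomSum-closed μ (suc L) = begin
  (1ℚ - μ) * (μ * (1ℚ ⊕ G))              ≡⟨ expand μ G ⟩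
  μ * (1ℚ - μ) ⊕ μ * ((1ℚ - μ) * G)      ≡⟨ cong (λ x → μ * (1ℚ - μ) ⊕ μ * x) (geomSum-closed μ L) ⟩
  μ * (1ℚ - μ) ⊕ μ * (μ * (1ℚ - μ ^' L)) ≡⟨ collect μ (μ ^' L) ⟩
  μ * (1ℚ - μ * μ ^' L)                  ∎
  where
  G : ℚ
  G = geomSum μ L
  expand : ∀ μ G → (1ℚ - μ) * (μ * (1ℚ ⊕ G)) ≡ μ * (1ℚ - μ) ⊕ μ * ((1ℚ - μ) * G)
  expand = solve-∀ ℚ-ring
  collect : ∀ μ u → μ * (1ℚ - μ) ⊕ μ * (μ * (1ℚ - u)) ≡ μ * (1ℚ - μ * u)
  collect = solve-∀ ℚ-ring

-- Σ_{1 ≤ i,j ≤ L} μ^|i-j|: going from L to L + 1 adds the entry 1 and twice μ + ⋯ + μ^L.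
correlationSum : ℚ → ℕ → ℚ
correlationSum μ zero    = 0ℚ
correlationSum μ (suc L) = correlationSum μ L ⊕ (1ℚ ⊕ fromℕ 2 * geomSum μ L)

correlationSum-closed : ∀ μ L →
  (1ℚ - μ) * (1ℚ - μ) * correlationSum μ L ≡ fromℕ L * (1ℚ ⊕ μ) * (1ℚ - μ) - fromℕ 2 * μ * (1ℚ - μ ^' L)
correlationSum-closed μ zero    = base μ
  where
  base : ∀ μ → (1ℚ - μ) * (1ℚ - μ) * 0ℚ ≡ 0ℚ * (1ℚ ⊕ μ) * (1ℚ - μ) - fromℕ 2 * μ * (1ℚ - 1ℚ)
  base = solve-∀ ℚ-ring
correlationSum-closed μ (suc L) = begin
  (1ℚ - μ) * (1ℚ - μ) * (C ⊕ (1ℚ ⊕ fromℕ 2 * G))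
    ≡⟨ expand μ C G ⟩
  (1ℚ - μ) * (1ℚ - μ) * C ⊕ ((1ℚ - μ) * (1ℚ - μ) ⊕ fromℕ 2 * (1ℚ - μ) * ((1ℚ - μ) * G))
    ≡⟨ cong₂ (λ x y → x ⊕ ((1ℚ - μ) * (1ℚ - μ) ⊕ fromℕ 2 * (1ℚ - μ) * y))
             (correlationSum-closed μ L) (geomSum-closed μ L) ⟩
  (fromℕ L * (1ℚ ⊕ μ) * (1ℚ - μ) - fromℕ 2 * μ * (1ℚ - μ ^' L))
    ⊕ ((1ℚ - μ) * (1ℚ - μ) ⊕ fromℕ 2 * (1ℚ - μ) * (μ * (1ℚ - μ ^' L)))
    ≡⟨ collect μ (fromℕ L) (μ ^' L) ⟩
  (1ℚ ⊕ fromℕ L) * (1ℚ ⊕ μ) * (1ℚ - μ) - fromℕ 2 * μ * (1ℚ - μ * μ ^' L)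
    ≡⟨ cong (λ l → l * (1ℚ ⊕ μ) * (1ℚ - μ) - fromℕ 2 * μ * (1ℚ - μ ^' suc L)) (fromℕ-suc L) ⟨
  fromℕ (suc L) * (1ℚ ⊕ μ) * (1ℚ - μ) - fromℕ 2 * μ * (1ℚ - μ ^' suc L)
    ∎
  where
  C G : ℚ
  C = correlationSum μ L
  G = geomSum μ L
  expand : ∀ μ C G → (1ℚ - μ) * (1ℚ - μ) * (C ⊕ (1ℚ ⊕ fromℕ 2 * G))
                   ≡ (1ℚ - μ) * (1ℚ - μ) * C ⊕ ((1ℚ - μ) * (1ℚ - μ) ⊕ fromℕ 2 * (1ℚ - μ) * ((1ℚ - μ) * G))
  expand = solve-∀ ℚ-ring
  collect : ∀ μ l u → (l * (1ℚ ⊕ μ) * (1ℚ - μ) - fromℕ 2 * μ * (1ℚ - u))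
                        ⊕ ((1ℚ - μ) * (1ℚ - μ) ⊕ fromℕ 2 * (1ℚ - μ) * (μ * (1ℚ - u)))
                    ≡ (1ℚ ⊕ l) * (1ℚ ⊕ μ) * (1ℚ - μ) - fromℕ 2 * μ * (1ℚ - μ * u)
  collect = solve-∀ ℚ-ring

correlationSum-formula : ∀ μ L → 1ℚ - μ ≢ 0ℚ →
  correlationSum μ L
    ≡ (fromℕ L * (1ℚ ⊕ μ)) ÷' (1ℚ - μ) - (fromℕ 2 * μ * (1ℚ - μ ^' L)) ÷' ((1ℚ - μ) * (1ℚ - μ))
correlationSum-formula μ L 1-μ≢0 =
  ÷'-by-square (1ℚ - μ) (fromℕ L * (1ℚ ⊕ μ)) (fromℕ 2 * μ * (1ℚ - μ ^' L)) 1-μ≢0 (correlationSum-closed μ L)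

toℚ : State → ℚ
toℚ σ = fromℕ (toℕ σ)

alphabet-nonempty : ∀ {N} {ty : Fin N → SymType} → 1 ≤ count ty GEN + count ty KILL → NonZero N
alphabet-nonempty {zero}  ()
alphabet-nonempty {suc N} _ = _

module Chain {N : ℕ} (ty : Fin N → SymType) (g+k≥1 : 1 ≤ count ty GEN + count ty KILL) where
  open Model ty

  π₀ π₁ N⁻¹ [g+k]⁻¹ : ℚ
  π₀      = π zero
  π₁      = π (suc zero)
  N⁻¹     = inv (fromℕ N)
  [g+k]⁻¹ = inv (fromℕ (g + k))

  N*N⁻¹ : fromℕ N * N⁻¹ ≡ 1ℚ
  N*N⁻¹ = inv-inverseʳ (fromℕ N) (fromℕ≢0 N {{alphabet-nonempty g+k≥1}})

  g+k≢0 : fromℕ (g + k) ≢ 0ℚ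
  g+k≢0 = fromℕ≢0 (g + k) {{>-nonZero g+k≥1}}

  [g+k]*[g+k]⁻¹ : fromℕ (g + k) * [g+k]⁻¹ ≡ 1ℚ
  [g+k]*[g+k]⁻¹ = inv-inverseʳ (fromℕ (g + k)) g+k≢0

  1-μ≡[g+k]*N⁻¹ : 1ℚ - μ ≡ fromℕ (g + k) * N⁻¹
  1-μ≡[g+k]*N⁻¹ = begin
    1ℚ - μ                                 ≡⟨ cong (_- μ) N*N⁻¹ ⟨
    fromℕ N * N⁻¹ - μ                      ≡⟨ cong (λ n → n * N⁻¹ - μ) (count-total ty) ⟨
    (fromℕ g ⊕ fromℕ t ⊕ fromℕ k) * N⁻¹ - μ ≡⟨ drop-t (fromℕ g) (fromℕ t) (fromℕ k) N⁻¹ ⟩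
    (fromℕ g ⊕ fromℕ k) * N⁻¹              ≡⟨ cong (_* N⁻¹) (fromℕ-+ g k) ⟨
    fromℕ (g + k) * N⁻¹                    ∎
    where
    drop-t : ∀ g t k i → (g ⊕ t ⊕ k) * i - t * i ≡ (g ⊕ k) * i
    drop-t = solve-∀ ℚ-ring

  1-μ≢0 : 1ℚ - μ ≢ 0ℚ
  1-μ≢0 1-μ≡0 = g+k≢0 (begin
    fromℕ (g + k)                    ≡⟨ ℚ.*-identityʳ (fromℕ (g + k)) ⟨
    fromℕ (g + k) * 1ℚ               ≡⟨ cong (fromℕ (g + k) *_) N*N⁻¹ ⟨
    fromℕ (g + k) * (fromℕ N * N⁻¹)  ≡⟨ swap (fromℕ (g + k)) (fromℕ N) N⁻¹ ⟩
    fromℕ (g + k) * N⁻¹ * fromℕ N    ≡⟨ cong (_* fromℕ N) (trans (sym 1-μ≡[g+k]*N⁻¹) 1-μ≡0) ⟩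
    0ℚ * fromℕ N                     ≡⟨ ℚ.*-zeroˡ (fromℕ N) ⟩
    0ℚ                               ∎)
    where
    swap : ∀ a b c → a * (b * c) ≡ a * c * b
    swap = solve-∀ ℚ-ring

  frequency-factor : ∀ n → fromℕ n * N⁻¹ ≡ (1ℚ - μ) * (fromℕ n ÷' fromℕ (g + k))
  frequency-factor n = sym (begin
    (1ℚ - μ) * (fromℕ n * [g+k]⁻¹)             ≡⟨ cong (_* (fromℕ n * [g+k]⁻¹)) 1-μ≡[g+k]*N⁻¹ ⟩
    fromℕ (g + k) * N⁻¹ * (fromℕ n * [g+k]⁻¹)  ≡⟨ regroup (fromℕ (g + k)) N⁻¹ (fromℕ n) [g+k]⁻¹ ⟩
    fromℕ n * N⁻¹ * (fromℕ (g + k) * [g+k]⁻¹)  ≡⟨ cong (fromℕ n * N⁻¹ *_) [g+k]*[g+k]⁻¹ ⟩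
    fromℕ n * N⁻¹ * 1ℚ                         ≡⟨ ℚ.*-identityʳ (fromℕ n * N⁻¹) ⟩
    fromℕ n * N⁻¹                              ∎)
    where
    regroup : ∀ a i n j → a * i * (n * j) ≡ n * i * (a * j)
    regroup = solve-∀ ℚ-ring

  π₀≡1-π₁ : π₀ ≡ 1ℚ - π₁
  π₀≡1-π₁ = begin
    π₀                                  ≡⟨ split (fromℕ g) (fromℕ k) [g+k]⁻¹ ⟩
    (fromℕ g ⊕ fromℕ k) * [g+k]⁻¹ - π₁  ≡⟨ cong (λ n → n * [g+k]⁻¹ - π₁) (fromℕ-+ g k) ⟨
    fromℕ (g + k) * [g+k]⁻¹ - π₁        ≡⟨ cong (_- π₁) [g+k]*[g+k]⁻¹ ⟩
    1ℚ - π₁                             ∎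
    where
    split : ∀ g k i → k * i ≡ (g ⊕ k) * i - g * i
    split = solve-∀ ℚ-ring

  Eπ : (State → ℚ) → ℚ
  Eπ h = sumFin 2 (λ σ → π σ * h σ)

  Eπ-cong : ∀ {h h′} → (∀ σ → h σ ≡ h′ σ) → Eπ h ≡ Eπ h′
  Eπ-cong eq = sumFin-cong 2 (λ σ → cong (π σ *_) (eq σ))

  Eπ-explicit : ∀ h → Eπ h ≡ (1ℚ - π₁) * h zero ⊕ π₁ * h (suc zero)
  Eπ-explicit h = cong₂ (λ p x → p * h zero ⊕ x) π₀≡1-π₁ (ℚ.+-identityʳ (π₁ * h (suc zero)))

  Eπ-centred : ∀ c β → Eπ (λ b → c ⊕ β * (toℚ b - π₁)) ≡ c
  Eπ-centred c β = trans (Eπ-explicit (λ b → c ⊕ β * (toℚ b - π₁))) (centred c β π₁)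
    where
    centred : ∀ c β p → (1ℚ - p) * (c ⊕ β * (0ℚ - p)) ⊕ p * (c ⊕ β * (1ℚ - p)) ≡ c
    centred = solve-∀ ℚ-ring

  transition : (State → ℚ) → State → ℚ
  transition h σ = sumFin N (λ x → N⁻¹ * h (act (ty x) σ))

  transition-cong : ∀ {h h′} σ → (∀ b → h b ≡ h′ b) → transition h σ ≡ transition h′ σ
  transition-cong σ eq = sumFin-cong N (λ x → cong (N⁻¹ *_) (eq (act (ty x) σ)))

  transition-mix : ∀ h σ → transition h σ ≡ μ * h σ ⊕ (1ℚ - μ) * Eπ h
  transition-mix h σ = begin
    transition h σ
      ≡⟨ sumFin-byType ty (λ T → N⁻¹ * h (act T σ)) ⟩
    fromℕ g * (N⁻¹ * h₁) ⊕ fromℕ t * (N⁻¹ * h σ) ⊕ fromℕ k * (N⁻¹ * h₀)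
      ≡⟨ regroup (fromℕ g) (fromℕ t) (fromℕ k) N⁻¹ h₁ (h σ) h₀ ⟩
    μ * h σ ⊕ (fromℕ k * N⁻¹ * h₀ ⊕ fromℕ g * N⁻¹ * h₁)
      ≡⟨ cong₂ (λ a b → μ * h σ ⊕ (a * h₀ ⊕ b * h₁))
               (trans (frequency-factor k) (cong ((1ℚ - μ) *_) π₀≡1-π₁)) (frequency-factor g) ⟩
    μ * h σ ⊕ ((1ℚ - μ) * (1ℚ - π₁) * h₀ ⊕ (1ℚ - μ) * π₁ * h₁)
      ≡⟨ cong (μ * h σ ⊕_) (factor (1ℚ - μ) (1ℚ - π₁) π₁ h₀ h₁) ⟩
    μ * h σ ⊕ (1ℚ - μ) * ((1ℚ - π₁) * h₀ ⊕ π₁ * h₁)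
      ≡⟨ cong (λ e → μ * h σ ⊕ (1ℚ - μ) * e) (Eπ-explicit h) ⟨
    μ * h σ ⊕ (1ℚ - μ) * Eπ h
      ∎
    where
    h₀ h₁ : ℚ
    h₀ = h zero
    h₁ = h (suc zero)
    regroup : ∀ g t k i x y z → g * (i * x) ⊕ t * (i * y) ⊕ k * (i * z) ≡ t * i * y ⊕ (k * i * z ⊕ g * i * x)
    regroup = solve-∀ ℚ-ring
    factor : ∀ a b c x y → a * b * x ⊕ a * c * y ≡ a * (b * x ⊕ c * y)
    factor = solve-∀ ℚ-ring

  Eπ-transition : ∀ h → Eπ (transition h) ≡ Eπ h
  Eπ-transition h = begin
    Eπ (transition h)
      ≡⟨ Eπ-explicit (transition h) ⟩
    (1ℚ - π₁) * transition h zero ⊕ π₁ * transition h (suc zero)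
      ≡⟨ cong₂ (λ a b → (1ℚ - π₁) * a ⊕ π₁ * b) (transition-mix h zero) (transition-mix h (suc zero)) ⟩
    (1ℚ - π₁) * (μ * h zero ⊕ (1ℚ - μ) * Eπ h) ⊕ π₁ * (μ * h (suc zero) ⊕ (1ℚ - μ) * Eπ h)
      ≡⟨ regroup π₁ μ (h zero) (h (suc zero)) (Eπ h) ⟩
    μ * ((1ℚ - π₁) * h zero ⊕ π₁ * h (suc zero)) ⊕ (1ℚ - μ) * Eπ h
      ≡⟨ cong (λ e → μ * e ⊕ (1ℚ - μ) * Eπ h) (Eπ-explicit h) ⟨
    μ * Eπ h ⊕ (1ℚ - μ) * Eπ h
      ≡⟨ convex μ (Eπ h) ⟩
    Eπ h
      ∎
    where
    regroup : ∀ p μ x y e → (1ℚ - p) * (μ * x ⊕ (1ℚ - μ) * e) ⊕ p * (μ * y ⊕ (1ℚ - μ) * e)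
                          ≡ μ * ((1ℚ - p) * x ⊕ p * y) ⊕ (1ℚ - μ) * e
    regroup = solve-∀ ℚ-ring
    convex : ∀ μ e → μ * e ⊕ (1ℚ - μ) * e ≡ e
    convex = solve-∀ ℚ-ring

  transition-centred : ∀ c β σ → transition (λ b → c ⊕ β * (toℚ b - π₁)) σ ≡ c ⊕ μ * β * (toℚ σ - π₁)
  transition-centred c β σ = begin
    transition (λ b → c ⊕ β * (toℚ b - π₁)) σ
      ≡⟨ transition-mix (λ b → c ⊕ β * (toℚ b - π₁)) σ ⟩
    μ * (c ⊕ β * (toℚ σ - π₁)) ⊕ (1ℚ - μ) * Eπ (λ b → c ⊕ β * (toℚ b - π₁))
      ≡⟨ cong (λ e → μ * (c ⊕ β * (toℚ σ - π₁)) ⊕ (1ℚ - μ) * e) (Eπ-centred c β) ⟩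
    μ * (c ⊕ β * (toℚ σ - π₁)) ⊕ (1ℚ - μ) * c
      ≡⟨ contract μ c β (toℚ σ - π₁) ⟩
    c ⊕ μ * β * (toℚ σ - π₁)
      ∎
    where
    contract : ∀ μ c β d → μ * (c ⊕ β * d) ⊕ (1ℚ - μ) * c ≡ c ⊕ μ * β * d
    contract = solve-∀ ℚ-ring

  sumWords-cong : ∀ L {f h : Vec (Fin N) L → ℚ} → (∀ w → f w ≡ h w) → sumWords L f ≡ sumWords L h
  sumWords-cong zero    eq = eq []
  sumWords-cong (suc L) eq = sumFin-cong N (λ x → cong (N⁻¹ *_) (sumWords-cong L (eq ∘ (x ∷_))))

  sumWords-+ : ∀ L (f h : Vec (Fin N) L → ℚ) → sumWords L (λ w → f w ⊕ h w) ≡ sumWords L f ⊕ sumWords L h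
  sumWords-+ zero    f h = refl
  sumWords-+ (suc L) f h = trans
    (sumFin-cong N (λ x → trans (cong (N⁻¹ *_) (sumWords-+ L (f ∘ (x ∷_)) (h ∘ (x ∷_))))
                                (ℚ.*-distribˡ-+ N⁻¹ _ _)))
    (sumFin-+ N _ _)

  sumWords-*ˡ : ∀ L c (f : Vec (Fin N) L → ℚ) → sumWords L (λ w → c * f w) ≡ c * sumWords L f
  sumWords-*ˡ zero    c f = refl
  sumWords-*ˡ (suc L) c f = trans
    (sumFin-cong N (λ x → trans (cong (N⁻¹ *_) (sumWords-*ˡ L c (f ∘ (x ∷_)))) (swap N⁻¹ c _)))
    (sumFin-*ˡ N c _)
    where
    swap : ∀ a b x → a * (b * x) ≡ b * (a * x)
    swap = solve-∀ ℚ-ring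

  sumWords-const : ∀ L c → sumWords L (λ _ → c) ≡ c
  sumWords-const zero    c = refl
  sumWords-const (suc L) c = begin
    sumFin N (λ _ → N⁻¹ * sumWords L (λ _ → c))  ≡⟨ sumFin-cong N (λ _ → cong (N⁻¹ *_) (sumWords-const L c)) ⟩
    sumFin N (λ _ → N⁻¹ * c)                     ≡⟨ sumFin-const N (N⁻¹ * c) ⟩
    fromℕ N * (N⁻¹ * c)                          ≡⟨ ℚ.*-assoc (fromℕ N) N⁻¹ c ⟨
    fromℕ N * N⁻¹ * c                            ≡⟨ cong (_* c) N*N⁻¹ ⟩
    1ℚ * c                                       ≡⟨ ℚ.*-identityˡ c ⟩
    c                                            ∎

  sumWords-shift : ∀ L x (f : Vec (Fin N) L → ℚ) → sumWords L (λ w → x ⊕ f w) ≡ x ⊕ sumWords L f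
  sumWords-shift L x f = trans (sumWords-+ L (λ _ → x) f) (cong (_⊕ sumWords L f) (sumWords-const L x))

  sumWords-shift² : ∀ L x (f : Vec (Fin N) L → ℚ) →
    sumWords L (λ w → (x ⊕ f w) * (x ⊕ f w))
      ≡ x * x ⊕ (fromℕ 2 * x * sumWords L f ⊕ sumWords L (λ w → f w * f w))
  sumWords-shift² L x f = begin
    sumWords L (λ w → (x ⊕ f w) * (x ⊕ f w))
      ≡⟨ sumWords-cong L (λ w → square x (f w)) ⟩
    sumWords L (λ w → x * x ⊕ (fromℕ 2 * x * f w ⊕ f w * f w))
      ≡⟨ sumWords-shift L (x * x) _ ⟩
    x * x ⊕ sumWords L (λ w → fromℕ 2 * x * f w ⊕ f w * f w)
      ≡⟨ cong (x * x ⊕_) (sumWords-+ L _ _) ⟩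
    x * x ⊕ (sumWords L (λ w → fromℕ 2 * x * f w) ⊕ sumWords L (λ w → f w * f w))
      ≡⟨ cong (λ y → x * x ⊕ (y ⊕ sumWords L (λ w → f w * f w))) (sumWords-*ˡ L (fromℕ 2 * x) f) ⟩
    x * x ⊕ (fromℕ 2 * x * sumWords L f ⊕ sumWords L (λ w → f w * f w))
      ∎
    where
    square : ∀ x y → (x ⊕ y) * (x ⊕ y) ≡ x * x ⊕ (fromℕ 2 * x * y ⊕ y * y)
    square = solve-∀ ℚ-ring

  firstMoment secondMoment : ℕ → State → ℚ
  firstMoment  L σ = sumWords L (λ w → fromℕ (ν σ w))
  secondMoment L σ = sumWords L (λ w → fromℕ (ν σ w) * fromℕ (ν σ w))

  firstMoment-suc : ∀ L σ → firstMoment (suc L) σ ≡ transition (λ b → toℚ b ⊕ firstMoment L b) σ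
  firstMoment-suc L σ = transition-cong σ (λ b →
    trans (sumWords-cong L (λ w → fromℕ-+ (toℕ b) (ν b w))) (sumWords-shift L (toℚ b) _))

  secondMoment-suc : ∀ L σ → secondMoment (suc L) σ
    ≡ transition (λ b → toℚ b * toℚ b ⊕ (fromℕ 2 * toℚ b * firstMoment L b ⊕ secondMoment L b)) σ
  secondMoment-suc L σ = transition-cong σ (λ b →
    trans (sumWords-cong L (λ w → cong₂ _*_ (fromℕ-+ (toℕ b) (ν b w)) (fromℕ-+ (toℕ b) (ν b w))))
          (sumWords-shift² L (toℚ b) _))

  firstMoment-closed : ∀ L σ → firstMoment L σ ≡ fromℕ L * π₁ ⊕ geomSum μ L * (toℚ σ - π₁)
  firstMoment-closed zero    σ = base π₁ (toℚ σ)
    where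
    base : ∀ p x → 0ℚ ≡ 0ℚ * p ⊕ 0ℚ * (x - p)
    base = solve-∀ ℚ-ring
  firstMoment-closed (suc L) σ = begin
    firstMoment (suc L) σ
      ≡⟨ firstMoment-suc L σ ⟩
    transition (λ b → toℚ b ⊕ firstMoment L b) σ
      ≡⟨ transition-cong σ (λ b → trans (cong (toℚ b ⊕_) (firstMoment-closed L b))
                                        (recentre (fromℕ L) π₁ (geomSum μ L) (toℚ b))) ⟩
    transition (λ b → (1ℚ ⊕ fromℕ L) * π₁ ⊕ (1ℚ ⊕ geomSum μ L) * (toℚ b - π₁)) σ
      ≡⟨ transition-centred ((1ℚ ⊕ fromℕ L) * π₁) (1ℚ ⊕ geomSum μ L) σ ⟩
    (1ℚ ⊕ fromℕ L) * π₁ ⊕ μ * (1ℚ ⊕ geomSum μ L) * (toℚ σ - π₁)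
      ≡⟨ cong (λ l → l * π₁ ⊕ geomSum μ (suc L) * (toℚ σ - π₁)) (fromℕ-suc L) ⟨
    fromℕ (suc L) * π₁ ⊕ geomSum μ (suc L) * (toℚ σ - π₁)
      ∎
    where
    recentre : ∀ l p G x → x ⊕ (l * p ⊕ G * (x - p)) ≡ (1ℚ ⊕ l) * p ⊕ (1ℚ ⊕ G) * (x - p)
    recentre = solve-∀ ℚ-ring

  Eπ-firstMoment : ∀ L → Eπ (firstMoment L) ≡ fromℕ L * π₁
  Eπ-firstMoment L = trans (Eπ-cong (firstMoment-closed L)) (Eπ-centred (fromℕ L * π₁) (geomSum μ L))

  Eπ-secondMoment-suc : ∀ L →
    Eπ (secondMoment (suc L)) ≡ π₁ * (1ℚ ⊕ fromℕ 2 * firstMoment L (suc zero)) ⊕ Eπ (secondMoment L)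
  Eπ-secondMoment-suc L = begin
    Eπ (secondMoment (suc L))                    ≡⟨ Eπ-cong (secondMoment-suc L) ⟩
    Eπ (transition Φ)                            ≡⟨ Eπ-transition Φ ⟩
    Eπ Φ                                         ≡⟨ Eπ-explicit Φ ⟩
    (1ℚ - π₁) * Φ zero ⊕ π₁ * Φ (suc zero)       ≡⟨ regroup π₁ (A zero) (A (suc zero)) (M zero) (M (suc zero)) ⟩
    π₁ * (1ℚ ⊕ fromℕ 2 * A (suc zero)) ⊕ ((1ℚ - π₁) * M zero ⊕ π₁ * M (suc zero))
      ≡⟨ cong (π₁ * (1ℚ ⊕ fromℕ 2 * A (suc zero)) ⊕_) (Eπ-explicit M) ⟨
    π₁ * (1ℚ ⊕ fromℕ 2 * A (suc zero)) ⊕ Eπ M    ∎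
    where
    A M Φ : State → ℚ
    A = firstMoment L
    M = secondMoment L
    Φ b = toℚ b * toℚ b ⊕ (fromℕ 2 * toℚ b * A b ⊕ M b)
    regroup : ∀ p a₀ a₁ m₀ m₁ →
      (1ℚ - p) * (0ℚ * 0ℚ ⊕ (fromℕ 2 * 0ℚ * a₀ ⊕ m₀)) ⊕ p * (1ℚ * 1ℚ ⊕ (fromℕ 2 * 1ℚ * a₁ ⊕ m₁))
        ≡ p * (1ℚ ⊕ fromℕ 2 * a₁) ⊕ ((1ℚ - p) * m₀ ⊕ p * m₁)
    regroup = solve-∀ ℚ-ring

  Eπ-secondMoment : ∀ L →
    Eπ (secondMoment L) ≡ fromℕ L * π₁ * (fromℕ L * π₁) ⊕ π₁ * (1ℚ - π₁) * correlationSum μ L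
  Eπ-secondMoment zero    = trans (Eπ-explicit (secondMoment zero)) (base π₁)
    where
    base : ∀ p → (1ℚ - p) * (0ℚ * 0ℚ) ⊕ p * (0ℚ * 0ℚ) ≡ 0ℚ * p * (0ℚ * p) ⊕ p * (1ℚ - p) * 0ℚ
    base = solve-∀ ℚ-ring
  Eπ-secondMoment (suc L) = begin
    Eπ (secondMoment (suc L))
      ≡⟨ Eπ-secondMoment-suc L ⟩
    π₁ * (1ℚ ⊕ fromℕ 2 * firstMoment L (suc zero)) ⊕ Eπ (secondMoment L)
      ≡⟨ cong₂ (λ a m → π₁ * (1ℚ ⊕ fromℕ 2 * a) ⊕ m) (firstMoment-closed L (suc zero)) (Eπ-secondMoment L) ⟩
    π₁ * (1ℚ ⊕ fromℕ 2 * (l * π₁ ⊕ G * (1ℚ - π₁))) ⊕ (l * π₁ * (l * π₁) ⊕ π₁ * (1ℚ - π₁) * C)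
      ≡⟨ regroup l π₁ G C ⟩
    (1ℚ ⊕ l) * π₁ * ((1ℚ ⊕ l) * π₁) ⊕ π₁ * (1ℚ - π₁) * (C ⊕ (1ℚ ⊕ fromℕ 2 * G))
      ≡⟨ cong (λ l′ → l′ * π₁ * (l′ * π₁) ⊕ π₁ * (1ℚ - π₁) * correlationSum μ (suc L)) (fromℕ-suc L) ⟨
    fromℕ (suc L) * π₁ * (fromℕ (suc L) * π₁) ⊕ π₁ * (1ℚ - π₁) * correlationSum μ (suc L)
      ∎
    where
    l G C : ℚ
    l = fromℕ L
    G = geomSum μ L
    C = correlationSum μ L
    regroup : ∀ l p G C →
      p * (1ℚ ⊕ fromℕ 2 * (l * p ⊕ G * (1ℚ - p))) ⊕ (l * p * (l * p) ⊕ p * (1ℚ - p) * C)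
        ≡ (1ℚ ⊕ l) * p * ((1ℚ ⊕ l) * p) ⊕ p * (1ℚ - p) * (C ⊕ (1ℚ ⊕ fromℕ 2 * G))
    regroup = solve-∀ ℚ-ring

  variance : ∀ L → Varν L ≡ π₁ * π₀ * correlationSum μ L
  variance L = begin
    Varν L                                ≡⟨ cong₂ (λ M m → M - m * m) (Eπ-secondMoment L) (Eπ-firstMoment L) ⟩
    (m * m ⊕ π₁ * (1ℚ - π₁) * C) - m * m  ≡⟨ cancel (m * m) (π₁ * (1ℚ - π₁) * C) ⟩
    π₁ * (1ℚ - π₁) * C                    ≡⟨ cong (λ q → π₁ * q * C) π₀≡1-π₁ ⟨
    π₁ * π₀ * C                           ∎
    where
    m C : ℚ
    m = fromℕ L * π₁
    C = correlationSum μ L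
    cancel : ∀ a b → (a ⊕ b) - a ≡ b
    cancel = solve-∀ ℚ-ring

-- The formula also holds for L = 0, where both sides vanish.
proposition6p4 : (N : ℕ) (ty : Fin N → SymType) →
    let open Model ty in
    1 ≤ g + k → (L : ℕ) → 1 ≤ L →
    Varν L ≡ (π (suc zero) * π zero) *
      ((fromℕ L * (1ℚ Data.Rational.+ μ)) ÷' (1ℚ - μ)
        - (fromℕ 2 * μ * (1ℚ - μ ^' L)) ÷' ((1ℚ - μ) * (1ℚ - μ)))
proposition6p4 N ty g+k≥1 L _ =
  trans (variance L) (cong (π₁ * π₀ *_) (correlationSum-formula μ L 1-μ≢0))
  where
  open Model ty
  open Chain ty g+k≥1
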